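{- For every integer $g \geq 5$, $f(1,1,g) = 2g-2$. That is, the minimum order of a mixed graph in which every vertex is incident with exactly $1$ edge, has out-degree exactly $1$, and which has girth $g$, equals $2g-2$.
   Context: A mixed graph $G$ is a finite graph having both undirected edges (called edges) and directed edges (called arcs). The degree of a vertex is the number of edges incident with it; its out-degree (resp. in-degree) is the number of arcs directed from (resp. to) it. A cycle in a mixed graph is a sequence of vertices $v_0, v_1, \dots, v_k$ with $v_0 = v_k$ such that each consecutive pair $v_i, v_{i+1}$ is joined either by an edge or by an arc directed from $v_i$ to $v_{i+1}$, and no edge or arc is used more than once; its length is $k$ (so cycles of length $1$ and $2$ are possible). The girth is the length of a shortest cycle. An $(r,z,g)$-graph is a mixed graph in which every vertex has degree $r$ and out-degree $z$, and which has girth $g$. $f(r,z,g)$ denotes the minimum order of an $(r,z,g)$-graph. -}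

module Defs where

open import Data.Nat using (ℕ; zero; suc; _+_; _≤_; _<_)
open import Data.Fin using (Fin; zero; suc; inject₁; fromℕ)
open import Data.Product using (Σ; _×_; _,_; proj₁; proj₂; Σ-syntax)
open import Data.Sum using (_⊎_; inj₁; inj₂)
open import Data.Bool using (Bool; true; false)
open import Relation.Nullary using (¬_)
open import Relation.Nullary.Decidable using (⌊_⌋)
open import Relation.Binary.PropositionalEquality using (_≡_)
open import Function.Definitions using (Injective)
import Data.Fin as F

count : {m : ℕ} → (Fin m → Bool) → ℕ
count {zero} p = 0
count {suc m} p with p zero
... | true  = suc (count (λ i → p (suc i)))
... | false = count (λ i → p (suc i))

-- A finite mixed graph on vertex set Fin n (multiple edges/arcs and loops allowed).
-- Edge e has endpoints (edgeEnds e) (unordered; the pair order is irrelevant),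
-- arc a is directed from tail a to head a.
record MixedGraph (n : ℕ) : Set where
  field
    nEdges   : ℕ
    edgeEnds : Fin nEdges → Fin n × Fin n
    nArcs    : ℕ
    tail     : Fin nArcs → Fin n
    head     : Fin nArcs → Fin n

  Link = Fin nEdges ⊎ Fin nArcs

  -- number of edges incident with v (a loop edge counts twice)
  degree : Fin n → ℕ
  degree v = count (λ e → ⌊ proj₁ (edgeEnds e) F.≟ v ⌋)
           + count (λ e → ⌊ proj₂ (edgeEnds e) F.≟ v ⌋)

  outDegree : Fin n → ℕ
  outDegree v = count (λ a → ⌊ tail a F.≟ v ⌋)

  inDegree : Fin n → ℕ
  inDegree v = count (λ a → ⌊ head a F.≟ v ⌋)

  data Step : Fin n → Fin n → Link → Set where
    edgeFwd : (e : Fin nEdges) → Step (proj₁ (edgeEnds e)) (proj₂ (edgeEnds e)) (inj₁ e)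
    edgeBwd : (e : Fin nEdges) → Step (proj₂ (edgeEnds e)) (proj₁ (edgeEnds e)) (inj₁ e)
    arcStep : (a : Fin nArcs) → Step (tail a) (head a) (inj₂ a)

  HasCycleOfLength : ℕ → Set
  HasCycleOfLength k =
    1 ≤ k ×
    Σ[ v ∈ (Fin (suc k) → Fin n) ] Σ[ s ∈ (Fin k → Link) ]
      (v zero ≡ v (fromℕ k)) ×
      (∀ i → Step (v (inject₁ i)) (v (suc i)) (s i)) ×
      Injective _≡_ _≡_ s

  HasGirth : ℕ → Set
  HasGirth g = HasCycleOfLength g × (∀ k → k < g → ¬ HasCycleOfLength k)

open MixedGraph public

IsRZGGraph : {n : ℕ} → MixedGraph n → ℕ → ℕ → ℕ → Set
IsRZGGraph {n} G r z g =
  (∀ v → degree G v ≡ r) × (∀ v → outDegree G v ≡ z) × HasGirth G g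

MinOrderIs : ℕ → ℕ → ℕ → ℕ → Set
MinOrderIs r z g m =
  Σ[ G ∈ MixedGraph m ] IsRZGGraph G r z g
  × (∀ n (H : MixedGraph n) → IsRZGGraph H r z g → m ≤ n)

-- In a (1,1,g)-graph the edges form a fixed-point-free involution `partner` and
-- the arcs a map `next`.  A periodic orbit of `next` of minimal period c is a
-- cycle of arcs, so c ≥ g.  If some vertex x of the orbit is matched to a vertex
-- y of the orbit, the edge xy together with either of the two arc paths between
-- x and y closes a cycle; the two lengths add up to c + 2, hence 2g ≤ c + 2 ≤ n + 2.
-- Otherwise the orbit and its image under `partner` are disjoint and n ≥ 2c ≥ 2g.
--
-- For the construction put m = g − 1, take the integers mod 2m as vertices, arcs
-- i → i + 1 and edges i — i + m.  Along a trail the position moves by 1 per arc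
-- and by m per edge, so a closed trail of length at most m that uses an arc would
-- have a total displacement A + Bm ≡ 0 (mod 2m) with 1 ≤ A and A + B ≤ m, which
-- is impossible; and a closed trail of edges alone cannot exist in a matching.
-- The edge 0 — m followed by the m arcs back to 0 is a cycle of length g.

module Submission where

open import Defs
open import Data.Bool using (Bool; true; false; not; T)
open import Data.Empty using (⊥; ⊥-elim)
open import Data.Fin as F
  using (Fin; zero; suc; toℕ; fromℕ<; fromℕ; splitAt; join; _↑ˡ_; _↑ʳ_)
open import Data.Fin.Properties
  using ( pigeonhole; any?; injective⇒≤; suc-injective; toℕ-injective; toℕ<n
        ; toℕ-fromℕ<; toℕ-fromℕ; toℕ-inject₁; toℕ-↑ˡ; toℕ-↑ʳ; ↑ˡ-injective; ↑ʳ-injective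
        ; splitAt-↑ˡ; splitAt-↑ʳ; splitAt⁻¹-↑ˡ; splitAt⁻¹-↑ʳ; join-splitAt )
open import Data.Nat
  using (ℕ; zero; suc; _+_; _*_; _∸_; _≤_; _<_; z≤n; s≤s; s≤s⁻¹; NonZero; >-nonZero)
open import Data.Nat.Properties
  using ( ≤-refl; ≤-reflexive; ≤-trans; <-≤-trans; ≤-<-trans; <⇒≤; ≮⇒≥; ≰⇒>; <-cmp; _≤?_
        ; m≤n⇒m≤1+n; m≤n⇒m<n∨m≡n; n<1+n; 1+n≰n; m+1+n≰m; 0≢1+n
        ; +-comm; +-suc; +-identityʳ; +-cancelˡ-≡; m≤m+n; m≤n+m; +-mono-≤; +-monoʳ-<
        ; m+n≤o⇒m≤o; m∸n≤m; m∸n+n≡m; m+[n∸m]≡n; m+n∸n≡m; m<n⇒0<n∸m; ∸-monoˡ-≤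
        ; module ≤-Reasoning )
open import Data.Nat.DivMod
  using ( _%_; _/_; m%n<n; m<n⇒m%n≡m; n%n≡0; m%n%n≡m%n; [m+n]%n≡m%n
        ; %-distribˡ-+; m≡m%n+[m/n]*n )
open import Data.Nat.Divisibility
  using (_∣_; divides; ∣-refl; ∣-trans; ∣⇒≤; ∣m∣n⇒∣m+n; ∣m+n∣m⇒∣n; n∣m*n)
open import Data.Nat.Tactic.RingSolver using (solve-∀)
open import Data.Product using (Σ; ∃; ∃₂; _×_; _,_; proj₁; proj₂; map)
open import Data.Sum using (inj₁; inj₂; [_,_]′)
open import Data.Sum.Properties using (inj₂-injective)
open import Data.Unit using (tt)
open import Function using (_∘_; id)
open import Function.Definitions using (Injective)
open import Relation.Binary.Definitions using (tri<; tri≈; tri>)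
open import Relation.Binary.PropositionalEquality
open import Relation.Nullary using (¬_; Dec; yes; no; contradiction)
open import Relation.Nullary.Decidable using (⌊_⌋; toWitness; fromWitness)

count-pos : ∀ {m} (p : Fin m → Bool) i → T (p i) → 1 ≤ count p
count-pos p zero pi with p zero
... | true = s≤s z≤n
count-pos p (suc i) pi with p zero
... | true = s≤s z≤n
... | false = count-pos (p ∘ suc) i pi

count-witness : ∀ {m} (p : Fin m → Bool) → 1 ≤ count p → ∃ λ i → T (p i)
count-witness {suc m} p h with p zero in eq
... | true = zero , subst T (sym eq) tt
... | false = map suc id (count-witness (p ∘ suc) h)

count-two : ∀ {m} (p : Fin m → Bool) {i j} → i ≢ j → T (p i) → T (p j) → 2 ≤ count p
count-two p {zero} {zero} i≢j _ _ = contradiction refl i≢j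
count-two p {zero} {suc j} _ pi pj with p zero
... | true = s≤s (count-pos (p ∘ suc) j pj)
count-two p {suc i} {zero} _ pi pj with p zero
... | true = s≤s (count-pos (p ∘ suc) i pi)
count-two p {suc i} {suc j} i≢j pi pj with p zero
... | true = m≤n⇒m≤1+n (count-two (p ∘ suc) (i≢j ∘ cong suc) pi pj)
... | false = count-two (p ∘ suc) (i≢j ∘ cong suc) pi pj

count≤1⇒unique : ∀ {m} (p : Fin m → Bool) {i j} → count p ≤ 1 → T (p i) → T (p j) → i ≡ j
count≤1⇒unique p {i} {j} h pi pj with i F.≟ j
... | yes i≡j = i≡j
... | no i≢j = contradiction (≤-trans (count-two p i≢j pi pj) h) λ { (s≤s ()) }

count-none : ∀ {m} (p : Fin m → Bool) → (∀ i → ¬ T (p i)) → count p ≡ 0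
count-none {zero} p _ = refl
count-none {suc m} p none with p zero | none zero
... | true | ¬p₀ = ⊥-elim (¬p₀ tt)
... | false | _ = count-none (p ∘ suc) (none ∘ suc)

count-single : ∀ {m} (p : Fin m → Bool) i → T (p i) → (∀ j → T (p j) → j ≡ i) → count p ≡ 1
count-single p zero pi unique with p zero
... | true = cong suc (count-none (p ∘ suc) (λ j pj → contradiction (unique (suc j) pj) λ ()))
count-single p (suc i) pi unique with p zero | unique zero
... | true | u = contradiction (u tt) λ ()
... | false | _ = count-single (p ∘ suc) i pi (λ j pj → suc-injective (unique (suc j) pj))

least-witness : {P : ℕ → Set} → (∀ k → Dec (P k)) → ∀ d → P d →
                ∃ λ c → P c × (∀ k → k < c → ¬ P k)
least-witness P? d Pd with P? 0
... | yes P₀ = 0 , P₀ , λ _ ()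
least-witness P? zero P₀ | no ¬P₀ = contradiction P₀ ¬P₀
least-witness P? (suc d) Pd | no ¬P₀ with least-witness (P? ∘ suc) d Pd
... | c , Pc , below = suc c , Pc , λ { zero _ → ¬P₀ ; (suc k) (s≤s k<c) → below k k<c }

residue : (x d : ℕ) .{{_ : NonZero d}} → Fin d
residue x d = fromℕ< (m%n<n x d)

toℕ-residue : ∀ x d .{{_ : NonZero d}} → toℕ (residue x d) ≡ x % d
toℕ-residue x d = toℕ-fromℕ< (m%n<n x d)

toℕ-residue-< : ∀ {x d} .{{_ : NonZero d}} → x < d → toℕ (residue x d) ≡ x
toℕ-residue-< {x} {d} x<d = trans (toℕ-residue x d) (m<n⇒m%n≡m x<d)

[m%d+n]%d≡[m+n]%d : ∀ x y d .{{_ : NonZero d}} → (x % d + y) % d ≡ (x + y) % d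
[m%d+n]%d≡[m+n]%d x y d = begin
  (x % d + y) % d            ≡⟨ %-distribˡ-+ (x % d) y d ⟩
  (x % d % d + y % d) % d    ≡⟨ cong (λ z → (z + y % d) % d) (m%n%n≡m%n x d) ⟩
  (x % d + y % d) % d        ≡⟨ %-distribˡ-+ x y d ⟨
  (x + y) % d                ∎
  where open ≡-Reasoning

residue-suc : ∀ x d .{{_ : NonZero d}} → residue (suc (toℕ (residue x d))) d ≡ residue (suc x) d
residue-suc x d = toℕ-injective (begin
  toℕ (residue (suc (toℕ (residue x d))) d)  ≡⟨ toℕ-residue (suc (toℕ (residue x d))) d ⟩
  suc (toℕ (residue x d)) % d               ≡⟨ cong (λ y → suc y % d) (toℕ-residue x d) ⟩
  suc (x % d) % d                           ≡⟨ cong (_% d) (+-comm 1 (x % d)) ⟩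
  (x % d + 1) % d                           ≡⟨ [m%d+n]%d≡[m+n]%d x 1 d ⟩
  (x + 1) % d                               ≡⟨ cong (_% d) (+-comm x 1) ⟩
  suc x % d                                 ≡⟨ toℕ-residue (suc x) d ⟨
  toℕ (residue (suc x) d)                   ∎)
  where open ≡-Reasoning

[m+n]%d≡m⇒d∣n : ∀ x y d .{{_ : NonZero d}} → (x + y) % d ≡ x → d ∣ y
[m+n]%d≡m⇒d∣n x y d eq = divides ((x + y) / d) (+-cancelˡ-≡ x y _ (begin
  x + y                          ≡⟨ m≡m%n+[m/n]*n (x + y) d ⟩
  (x + y) % d + (x + y) / d * d  ≡⟨ cong (_+ (x + y) / d * d) eq ⟩
  x + (x + y) / d * d            ∎))
  where open ≡-Reasoning

no-double-multiple : ∀ {m A B} → 1 ≤ A → A + B ≤ m → ¬ (m + m) ∣ A + B * m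
no-double-multiple {zero} {A} {B} 1≤A A+B≤0 _ = 1+n≰n (≤-trans 1≤A (m+n≤o⇒m≤o A A+B≤0))
no-double-multiple {suc m} {A} {zero} 1≤A A≤m 2m∣A =
  m+1+n≰m (suc m) (≤-trans (∣⇒≤ ⦃ >-nonZero (≤-trans 1≤A (m≤m+n A 0)) ⦄ 2m∣A) A≤m)
no-double-multiple {suc m} {A} {suc B} 1≤A A+B≤m 2m∣A+Bm =
  m+1+n≰m A (≤-trans A+B≤m (∣⇒≤ ⦃ >-nonZero 1≤A ⦄ m∣A))
  where
    m∣A : suc m ∣ A
    m∣A = ∣m+n∣m⇒∣n (subst (suc m ∣_) (+-comm A _) (∣-trans (∣m∣n⇒∣m+n ∣-refl ∣-refl) 2m∣A+Bm))
                     (n∣m*n (suc B))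

-- A cycle indexed by ℕ instead of Fin; only the indices up to k matter.
record ClosedTrail {n : ℕ} (G : MixedGraph n) (k : ℕ) : Set where
  field
    vertex : ℕ → Fin n
    link   : ℕ → Link G
    closed : vertex 0 ≡ vertex k
    step   : ∀ i → i < k → Step G (vertex i) (vertex (suc i)) (link i)
    link-injective : ∀ i j → i < k → j < k → link i ≡ link j → i ≡ j

module _ {n : ℕ} {G : MixedGraph n} where

  closedTrail⇒cycle : ∀ {k} → 1 ≤ k → ClosedTrail G k → HasCycleOfLength G k
  closedTrail⇒cycle {k} 1≤k trail =
    1≤k , vertex ∘ toℕ , link ∘ toℕ ,
    trans closed (cong vertex (sym (toℕ-fromℕ k))) ,
    (λ i → subst (λ x → Step G (vertex x) (vertex (suc (toℕ i))) (link (toℕ i)))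
                 (sym (toℕ-inject₁ i)) (step (toℕ i) (toℕ<n i))) ,
    (λ eq → toℕ-injective (link-injective _ _ (toℕ<n _) (toℕ<n _) eq))
    where open ClosedTrail trail

  cycle⇒closedTrail : ∀ {k} → HasCycleOfLength G k → ClosedTrail G k
  cycle⇒closedTrail {suc k} (_ , v , s , closed , step , s-injective) = record
    { vertex = λ x → v (residue x (2 + k))
    ; link = λ x → s (residue x (suc k))
    ; closed = trans (cong v (residue-index zero refl))
                     (trans closed (cong v (sym (residue-index (fromℕ (suc k)) (toℕ-fromℕ (suc k))))))
    ; step = step'
    ; link-injective = λ i j i< j< eq →
        trans (sym (toℕ-residue-< i<)) (trans (cong toℕ (s-injective eq)) (toℕ-residue-< j<))
    }
    where
      residue-index : ∀ {x} (i : Fin (2 + k)) → toℕ i ≡ x → residue x (2 + k) ≡ i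
      residue-index i refl = toℕ-injective (toℕ-residue-< (toℕ<n i))

      step' : ∀ i → i < suc k →
              Step G (v (residue i (2 + k))) (v (residue (suc i) (2 + k))) (s (residue i (suc k)))
      step' i i< = subst₂ (λ a b → Step G (v a) (v b) (s j))
        (sym (residue-index (F.inject₁ j) (trans (toℕ-inject₁ j) (toℕ-residue-< i<))))
        (sym (residue-index (suc j) (cong suc (toℕ-residue-< i<))))
        (step j)
        where j = residue i (suc k)

module DegreeOne {n : ℕ} (G : MixedGraph n) (deg : ∀ v → degree G v ≡ 1) where

  end : Bool → Fin (nEdges G) → Fin n
  end true  e = proj₁ (edgeEnds G e)
  end false e = proj₂ (edgeEnds G e)

  ends-at : Bool → Fin n → Fin (nEdges G) → Bool
  ends-at b v e = ⌊ end b e F.≟ v ⌋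

  end-step : ∀ b e → Step G (end b e) (end (not b) e) (inj₁ e)
  end-step true  e = edgeFwd e
  end-step false e = edgeBwd e

  private
    side≤1 : ∀ b v → count (ends-at b v) ≤ 1
    side≤1 true  v = ≤-trans (m≤m+n _ _) (≤-reflexive (deg v))
    side≤1 false v = ≤-trans (m≤n+m _ _) (≤-reflexive (deg v))

    same-side : ∀ b {v e e'} → end b e ≡ v → end b e' ≡ v → e ≡ e'
    same-side b {v} p q = count≤1⇒unique (ends-at b v) (side≤1 b v) (fromWitness p) (fromWitness q)

    both-sides : ∀ {v e e'} → end true e ≡ v → end false e' ≡ v → ⊥
    both-sides {v} {e} {e'} p q =
      1+n≰n (≤-trans (+-mono-≤ (count-pos (ends-at true v) e (fromWitness p))
                               (count-pos (ends-at false v) e' (fromWitness q)))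
                     (≤-reflexive (deg v)))

  dart-unique : ∀ {v} b b' {e e'} → end b e ≡ v → end b' e' ≡ v → (b , e) ≡ (b' , e')
  dart-unique true  true  p q = cong (true ,_) (same-side true p q)
  dart-unique false false p q = cong (false ,_) (same-side false p q)
  dart-unique true  false p q = ⊥-elim (both-sides p q)
  dart-unique false true  p q = ⊥-elim (both-sides q p)

  dart-at : ∀ v → Σ (Bool × Fin (nEdges G)) λ d → end (proj₁ d) (proj₂ d) ≡ v
  dart-at v with count (ends-at true v) | count-witness (ends-at true v) | count-witness (ends-at false v) | deg v
  ... | zero  | _ | w | deg≡ = map (false ,_) toWitness (w (≤-reflexive (sym deg≡)))
  ... | suc _ | w | _ | _    = map (true ,_) toWitness (w (s≤s z≤n))

  edgeAt : Fin n → Fin (nEdges G)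
  edgeAt v = proj₂ (proj₁ (dart-at v))

  partner : Fin n → Fin n
  partner v = end (not (proj₁ (proj₁ (dart-at v)))) (edgeAt v)

  step-partner : ∀ v → Step G v (partner v) (inj₁ (edgeAt v))
  step-partner v with dart-at v
  ... | (b , e) , refl = end-step b e

  private
    edgeAt-end : ∀ b e → edgeAt (end b e) ≡ e × partner (end b e) ≡ end (not b) e
    edgeAt-end b e = cong proj₂ same , cong (λ d → end (not (proj₁ d)) (proj₂ d)) same
      where same = dart-unique (proj₁ (proj₁ (dart-at (end b e)))) b (proj₂ (dart-at (end b e))) refl

  edge-step : ∀ {a b e} → Step G a b (inj₁ e) → edgeAt a ≡ e × partner a ≡ b
  edge-step (edgeFwd e) = edgeAt-end true e
  edge-step (edgeBwd e) = edgeAt-end false e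

  edge-step-sym : ∀ {a b e} → Step G a b (inj₁ e) → Step G b a (inj₁ e)
  edge-step-sym (edgeFwd e) = edgeBwd e
  edge-step-sym (edgeBwd e) = edgeFwd e

  consecutive-edges : ∀ {a b c e e'} → Step G a b (inj₁ e) → Step G b c (inj₁ e') → e ≡ e'
  consecutive-edges s s' = trans (sym (proj₁ (edge-step (edge-step-sym s)))) (proj₁ (edge-step s'))

  partner-involutive : ∀ v → partner (partner v) ≡ v
  partner-involutive v = proj₂ (edge-step (edge-step-sym (step-partner v)))

  partner-injective : ∀ {u v} → partner u ≡ partner v → u ≡ v
  partner-injective {u} {v} eq =
    trans (sym (partner-involutive u)) (trans (cong partner eq) (partner-involutive v))

  partner-irreflexive : ∀ v → partner v ≢ v
  partner-irreflexive v eq with dart-at v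
  ... | (b , e) , refl = not-≢ b (cong proj₁ (dart-unique (not b) b eq refl))
    where
      not-≢ : ∀ b → not b ≢ b
      not-≢ true  ()
      not-≢ false ()

  no-edge-loop : ∀ {a e} → ¬ Step G a a (inj₁ e)
  no-edge-loop {a} s = partner-irreflexive a (proj₂ (edge-step s))

  no-edge-closedTrail : ∀ {k} → 1 ≤ k → (trail : ClosedTrail G k) →
                        (∀ i → i < k → ∃ λ e → ClosedTrail.link trail i ≡ inj₁ e) → ⊥
  no-edge-closedTrail {suc zero} _ trail edges with edges 0 (s≤s z≤n)
  ... | e , eq = no-edge-loop (subst₂ (Step G (vertex 0)) (sym closed) eq (step 0 (s≤s z≤n)))
    where open ClosedTrail trail
  no-edge-closedTrail {suc (suc k)} _ trail edges with edges 0 (s≤s z≤n) | edges 1 (s≤s (s≤s z≤n))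
  ... | e₀ , eq₀ | e₁ , eq₁ = 0≢1+n (link-injective 0 1 (s≤s z≤n) (s≤s (s≤s z≤n))
          (trans eq₀ (trans (cong inj₁ (consecutive-edges step₀ step₁)) (sym eq₁))))
    where
      open ClosedTrail trail
      step₀ = subst (Step G (vertex 0) (vertex 1)) eq₀ (step 0 (s≤s z≤n))
      step₁ = subst (Step G (vertex 1) (vertex 2)) eq₁ (step 1 (s≤s (s≤s z≤n)))

module Periodic {A : Set} (f : A → A) where

  open import Function.Endo.Propositional A using (_^_; ^-homo) public
  open ≡-Reasoning

  ^-+ : ∀ a b x → (f ^ (a + b)) x ≡ (f ^ a) ((f ^ b) x)
  ^-+ a b x = cong-app (^-homo f a b) x

  ^-comm : ∀ a b x → (f ^ a) ((f ^ b) x) ≡ (f ^ b) ((f ^ a) x)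
  ^-comm a b x = trans (sym (^-+ a b x)) (trans (cong (λ k → (f ^ k) x) (+-comm a b)) (^-+ b a x))

  ^-return : ∀ {c d u} → (f ^ c) u ≡ u → d ≤ c → (f ^ (c ∸ d)) ((f ^ d) u) ≡ u
  ^-return {c} {d} {u} fᶜu≡u d≤c =
    trans (sym (^-+ (c ∸ d) d u)) (trans (cong (λ k → (f ^ k) u) (m∸n+n≡m d≤c)) fᶜu≡u)

  record MinimalPeriod (u : A) (c : ℕ) : Set where
    field
      period-pos : 1 ≤ c
      periodic   : (f ^ c) u ≡ u
      minimal    : ∀ k → 1 ≤ k → k < c → (f ^ k) u ≢ u

  module _ {u c} (mp : MinimalPeriod u c) where
    open MinimalPeriod mp

    private
      no-repeat : ∀ {i j} → i < j → j < c → (f ^ i) u ≢ (f ^ j) u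
      no-repeat {i} {j} i<j j<c eq = minimal (c ∸ j + i)
        (≤-trans (m<n⇒0<n∸m j<c) (m≤m+n (c ∸ j) i))
        (<-≤-trans (+-monoʳ-< (c ∸ j) i<j) (≤-reflexive (m∸n+n≡m (<⇒≤ j<c))))
        (begin
          (f ^ (c ∸ j + i)) u        ≡⟨ ^-+ (c ∸ j) i u ⟩
          (f ^ (c ∸ j)) ((f ^ i) u)  ≡⟨ cong (f ^ (c ∸ j)) eq ⟩
          (f ^ (c ∸ j)) ((f ^ j) u)  ≡⟨ ^-return periodic (<⇒≤ j<c) ⟩
          u                          ∎)

    ^-injective : ∀ {i j} → i < c → j < c → (f ^ i) u ≡ (f ^ j) u → i ≡ j
    ^-injective {i} {j} i<c j<c eq with <-cmp i j
    ... | tri< i<j _ _ = ⊥-elim (no-repeat i<j j<c eq)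
    ... | tri≈ _ i≡j _ = i≡j
    ... | tri> _ _ j<i = ⊥-elim (no-repeat j<i i<c (sym eq))

    rotate : ∀ {d} → d ≤ c → MinimalPeriod ((f ^ d) u) c
    rotate {d} d≤c = record
      { period-pos = period-pos
      ; periodic = trans (^-comm c d u) (cong (f ^ d) periodic)
      ; minimal = λ k 1≤k k<c eq → minimal k 1≤k k<c (begin
          (f ^ k) u                              ≡⟨ cong (f ^ k) (sym (^-return periodic d≤c)) ⟩
          (f ^ k) ((f ^ (c ∸ d)) ((f ^ d) u))    ≡⟨ ^-comm k (c ∸ d) _ ⟩
          (f ^ (c ∸ d)) ((f ^ k) ((f ^ d) u))    ≡⟨ cong (f ^ (c ∸ d)) eq ⟩
          (f ^ (c ∸ d)) ((f ^ d) u)              ≡⟨ ^-return periodic d≤c ⟩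
          u                                      ∎)
      }

    orbit-connected : ∀ {s t} → s < c → t < c → ∃ λ r → r < c × (f ^ r) ((f ^ s) u) ≡ (f ^ t) u
    orbit-connected {s} {t} s<c t<c with s ≤? t
    ... | yes s≤t = t ∸ s , ≤-<-trans (m∸n≤m t s) t<c ,
                    trans (sym (^-+ (t ∸ s) s u)) (cong (λ k → (f ^ k) u) (m∸n+n≡m s≤t))
    ... | no s≰t =
      c ∸ s + t , <-≤-trans (+-monoʳ-< (c ∸ s) (≰⇒> s≰t)) (≤-reflexive (m∸n+n≡m (<⇒≤ s<c))) ,
        (begin
          (f ^ (c ∸ s + t)) ((f ^ s) u)            ≡⟨ cong (λ k → (f ^ k) ((f ^ s) u)) (+-comm (c ∸ s) t) ⟩
          (f ^ (t + (c ∸ s))) ((f ^ s) u)          ≡⟨ ^-+ t (c ∸ s) _ ⟩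
          (f ^ t) ((f ^ (c ∸ s)) ((f ^ s) u))      ≡⟨ cong (f ^ t) (^-return periodic (<⇒≤ s<c)) ⟩
          (f ^ t) u                                ∎)

  orbit : A → (c : ℕ) → Fin c → A
  orbit u c i = (f ^ toℕ i) u

  orbit-injective : ∀ {u c} → MinimalPeriod u c → Injective _≡_ _≡_ (orbit u c)
  orbit-injective mp eq = toℕ-injective (^-injective mp (toℕ<n _) (toℕ<n _) eq)

minimalPeriod-exists : ∀ {n} (f : Fin n → Fin n) → Fin n → ∃₂ (Periodic.MinimalPeriod f)
minimalPeriod-exists {n} f v with pigeonhole (n<1+n n) (λ i → (f ^ toℕ i) v)
  where open Periodic f
... | i , j , i<j , fⁱv≡fʲv = u , minimize (least-witness (λ k → (f ^ suc k) u F.≟ u) d returns)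
  where
    open Periodic f
    open ≡-Reasoning
    u = (f ^ toℕ i) v
    d = toℕ j ∸ suc (toℕ i)

    returns : (f ^ suc d) u ≡ u
    returns = begin
      (f ^ suc d) ((f ^ toℕ i) v)  ≡⟨ ^-+ (suc d) (toℕ i) v ⟨
      (f ^ (suc d + toℕ i)) v      ≡⟨ cong (λ k → (f ^ k) v) (trans (sym (+-suc d _)) (m∸n+n≡m i<j)) ⟩
      (f ^ toℕ j) v                ≡⟨ fⁱv≡fʲv ⟨
      u                            ∎

    minimize : (∃ λ c → (f ^ suc c) u ≡ u × (∀ k → k < c → (f ^ suc k) u ≢ u)) →
               ∃ (MinimalPeriod u)
    minimize (c , periodic , below) = suc c , record
      { period-pos = s≤s z≤n
      ; periodic = periodic
      ; minimal = λ { (suc k) _ (s≤s k<c) → below k k<c }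
      }

[,]∘splitAt-injective : ∀ {a b} {B : Set} {g : Fin a → B} {h : Fin b → B} →
  Injective _≡_ _≡_ g → Injective _≡_ _≡_ h → (∀ i j → g i ≢ h j) →
  Injective _≡_ _≡_ ([ g , h ]′ ∘ splitAt a)
[,]∘splitAt-injective {a} {b} {g = g} {h} g-inj h-inj disjoint {i} {j} eq =
  trans (sym (join-splitAt a b i))
        (trans (cong (join a b) (split-injective (splitAt a i) (splitAt a j) eq)) (join-splitAt a b j))
  where
    split-injective : ∀ x y → [ g , h ]′ x ≡ [ g , h ]′ y → x ≡ y
    split-injective (inj₁ x) (inj₁ y) eq = cong inj₁ (g-inj eq)
    split-injective (inj₁ x) (inj₂ y) eq = ⊥-elim (disjoint x y eq)
    split-injective (inj₂ x) (inj₁ y) eq = ⊥-elim (disjoint y x (sym eq))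
    split-injective (inj₂ x) (inj₂ y) eq = cong inj₂ (h-inj eq)

module OneOneGraph {n : ℕ} (H : MixedGraph n)
                   (deg : ∀ v → degree H v ≡ 1) (out : ∀ v → outDegree H v ≡ 1) where

  open DegreeOne H deg

  private
    out-arc : ∀ v → ∃ λ a → T ⌊ tail H a F.≟ v ⌋
    out-arc v = count-witness (λ a → ⌊ tail H a F.≟ v ⌋) (≤-reflexive (sym (out v)))

  arcAt : Fin n → Fin (nArcs H)
  arcAt v = proj₁ (out-arc v)

  tail-arcAt : ∀ v → tail H (arcAt v) ≡ v
  tail-arcAt v = toWitness (proj₂ (out-arc v))

  next : Fin n → Fin n
  next v = head H (arcAt v)

  step-next : ∀ v → Step H v (next v) (inj₂ (arcAt v))
  step-next v = subst (λ x → Step H x (next v) (inj₂ (arcAt v))) (tail-arcAt v) (arcStep (arcAt v))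

  arcAt-injective : ∀ {u v} → arcAt u ≡ arcAt v → u ≡ v
  arcAt-injective {u} {v} eq = trans (sym (tail-arcAt u)) (trans (cong (tail H) eq) (tail-arcAt v))

  open Periodic next

  arc-cycle : ∀ {u c} → MinimalPeriod u c → HasCycleOfLength H c
  arc-cycle {u} mp = closedTrail⇒cycle period-pos record
    { vertex = λ i → (next ^ i) u
    ; link = λ i → inj₂ (arcAt ((next ^ i) u))
    ; closed = sym periodic
    ; step = λ i _ → step-next _
    ; link-injective = λ i j i<c j<c eq → ^-injective mp i<c j<c (arcAt-injective (inj₂-injective eq))
    }
    where open MinimalPeriod mp

  edge-arcs-cycle : ∀ {x y c r} → MinimalPeriod y c → partner x ≡ y → r ≤ c → (next ^ r) y ≡ x →
                    HasCycleOfLength H (suc r)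
  edge-arcs-cycle {x} {y} {c} {r} mp px≡y r≤c fʳy≡x = closedTrail⇒cycle (s≤s z≤n) record
    { vertex = vertex
    ; link = link
    ; closed = sym fʳy≡x
    ; step = step
    ; link-injective = link-injective
    }
    where
      vertex : ℕ → Fin n
      vertex zero = x
      vertex (suc i) = (next ^ i) y

      link : ℕ → Link H
      link zero = inj₁ (edgeAt x)
      link (suc i) = inj₂ (arcAt ((next ^ i) y))

      step : ∀ i → i < suc r → Step H (vertex i) (vertex (suc i)) (link i)
      step zero _ = subst (λ z → Step H x z (link 0)) px≡y (step-partner x)
      step (suc i) _ = step-next _

      link-injective : ∀ i j → i < suc r → j < suc r → link i ≡ link j → i ≡ j
      link-injective zero zero _ _ _ = refl
      link-injective (suc i) (suc j) (s≤s i<r) (s≤s j<r) eq =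
        cong suc (^-injective mp (<-≤-trans i<r r≤c) (<-≤-trans j<r r≤c)
                              (arcAt-injective (inj₂-injective eq)))

  partner-off-orbit : ∀ {u c} → MinimalPeriod u c →
                      (∀ t s → partner (orbit u c t) ≢ orbit u c s) → c + c ≤ n
  partner-off-orbit mp disjoint = injective⇒≤ ([,]∘splitAt-injective
    (orbit-injective mp) (orbit-injective mp ∘ partner-injective) (λ i j eq → disjoint j i (sym eq)))

  module _ {g} (girth : HasGirth H g) where

    2g≡g+g : 2 * g ≡ g + g
    2g≡g+g = cong (g +_) (+-identityʳ g)

    girth-≤ : ∀ {k} → HasCycleOfLength H k → g ≤ k
    girth-≤ cycle = ≮⇒≥ (λ k<g → proj₂ girth _ k<g cycle)

    partner-on-orbit : ∀ {u c t s} → MinimalPeriod u c → t < c → s < c →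
                       partner ((next ^ t) u) ≡ (next ^ s) u → g + g ≤ c + 2
    partner-on-orbit {u} {c} {t} {s} mp t<c s<c px≡y with orbit-connected mp s<c t<c
    ... | r , r<c , fʳy≡x = begin
      g + g                ≤⟨ +-mono-≤ (girth-≤ (edge-arcs-cycle mpy px≡y (<⇒≤ r<c) fʳy≡x))
                                       (girth-≤ (edge-arcs-cycle mpx py≡x (m∸n≤m c r) fᶜ⁻ʳx≡y)) ⟩
      suc r + suc (c ∸ r)  ≡⟨ cong suc (+-suc r (c ∸ r)) ⟩
      suc (suc (r + (c ∸ r))) ≡⟨ cong (λ k → suc (suc k)) (m+[n∸m]≡n (<⇒≤ r<c)) ⟩
      suc (suc c)          ≡⟨ +-comm 2 c ⟩
      c + 2                ∎
      where
        open ≤-Reasoning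
        x = (next ^ t) u
        y = (next ^ s) u
        mpx = rotate mp (<⇒≤ t<c)
        mpy = rotate mp (<⇒≤ s<c)
        py≡x : partner y ≡ x
        py≡x = trans (cong partner (sym px≡y)) (partner-involutive x)
        fᶜ⁻ʳx≡y : (next ^ (c ∸ r)) x ≡ y
        fᶜ⁻ʳx≡y = trans (cong (next ^ (c ∸ r)) (sym fʳy≡x))
                        (^-return (MinimalPeriod.periodic mpy) (<⇒≤ r<c))

    order-lowerBound : 2 * g ∸ 2 ≤ n
    order-lowerBound with minimalPeriod-exists next (proj₁ (proj₂ (proj₁ girth)) zero)
    ... | u , c , mp with any? (λ t → any? (λ s → partner (orbit u c t) F.≟ orbit u c s))
    ... | yes (t , s , eq) = begin
      2 * g ∸ 2  ≡⟨ cong (_∸ 2) 2g≡g+g ⟩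
      g + g ∸ 2  ≤⟨ ∸-monoˡ-≤ 2 (partner-on-orbit mp (toℕ<n t) (toℕ<n s) eq) ⟩
      c + 2 ∸ 2  ≡⟨ m+n∸n≡m c 2 ⟩
      c          ≤⟨ injective⇒≤ (orbit-injective mp) ⟩
      n          ∎
      where open ≤-Reasoning
    ... | no ∄ = begin
      2 * g ∸ 2  ≤⟨ m∸n≤m (2 * g) 2 ⟩
      2 * g      ≡⟨ 2g≡g+g ⟩
      g + g      ≤⟨ +-mono-≤ g≤c g≤c ⟩
      c + c      ≤⟨ partner-off-orbit mp (λ t s eq → ∄ (t , s , eq)) ⟩
      n          ∎
      where
        open ≤-Reasoning
        g≤c = girth-≤ (arc-cycle mp)

module Construction (k : ℕ) where

  m M : ℕ
  m = suc k
  M = m + m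

  -- Vertices are the integers mod 2m; the edges join i to i + m, the arcs go from i to i + 1.
  G : MixedGraph M
  G = record
    { nEdges = m
    ; edgeEnds = λ e → e ↑ˡ m , m ↑ʳ e
    ; nArcs = M
    ; tail = id
    ; head = λ a → residue (suc (toℕ a)) M
    }

  ↑ˡ≢↑ʳ : ∀ (i j : Fin m) → i ↑ˡ m ≢ m ↑ʳ j
  ↑ˡ≢↑ʳ i j eq = contradiction
    (trans (sym (splitAt-↑ˡ m i m)) (trans (cong (splitAt m) eq) (splitAt-↑ʳ m m j))) λ ()

  left-end-at right-end-at : Fin M → Fin m → Bool
  left-end-at v e = ⌊ e ↑ˡ m F.≟ v ⌋
  right-end-at v e = ⌊ m ↑ʳ e F.≟ v ⌋

  degree-one : ∀ v → degree G v ≡ 1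
  degree-one v with splitAt m v in split
  ... | inj₁ e with refl ← splitAt⁻¹-↑ˡ {i = v} split = cong₂ _+_
    (count-single (left-end-at v) e (fromWitness refl) (λ j p → ↑ˡ-injective m j e (toWitness p)))
    (count-none (right-end-at v) (λ j p → ↑ˡ≢↑ʳ e j (sym (toWitness p))))
  ... | inj₂ e with refl ← splitAt⁻¹-↑ʳ {i = v} split = cong₂ _+_
    (count-none (left-end-at v) (λ j p → ↑ˡ≢↑ʳ j e (toWitness p)))
    (count-single (right-end-at v) e (fromWitness refl) (λ j p → ↑ʳ-injective m j e (toWitness p)))

  outDegree-one : ∀ v → outDegree G v ≡ 1
  outDegree-one v = count-single (λ a → ⌊ a F.≟ v ⌋) v (fromWitness refl) (λ j p → toWitness p)

  isArc isEdge : Link G → ℕ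
  isArc (inj₁ _) = 0
  isArc (inj₂ _) = 1
  isEdge (inj₁ _) = 1
  isEdge (inj₂ _) = 0

  shift : Link G → ℕ
  shift l = isArc l + isEdge l * m

  step-shift : ∀ {a b l} → Step G a b l → toℕ b ≡ (toℕ a + shift l) % M
  step-shift (edgeFwd e) = begin
    toℕ (m ↑ʳ e)                       ≡⟨ toℕ-↑ʳ m e ⟩
    m + toℕ e                          ≡⟨ m<n⇒m%n≡m (+-monoʳ-< m (toℕ<n e)) ⟨
    (m + toℕ e) % M                    ≡⟨ cong (_% M) (edge-forward (toℕ e) m) ⟩
    (toℕ e + shift (inj₁ e)) % M       ≡⟨ cong (λ x → (x + shift (inj₁ e)) % M) (toℕ-↑ˡ e m) ⟨
    (toℕ (e ↑ˡ m) + shift (inj₁ e)) % M ∎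
    where
      open ≡-Reasoning
      edge-forward : ∀ x m → m + x ≡ x + (0 + 1 * m)
      edge-forward = solve-∀
  step-shift (edgeBwd e) = begin
    toℕ (e ↑ˡ m)                       ≡⟨ toℕ-↑ˡ e m ⟩
    toℕ e                              ≡⟨ m<n⇒m%n≡m (<-≤-trans (toℕ<n e) (m≤m+n m m)) ⟨
    toℕ e % M                          ≡⟨ [m+n]%n≡m%n (toℕ e) M ⟨
    (toℕ e + M) % M                    ≡⟨ cong (_% M) (edge-backward (toℕ e) m) ⟩
    (m + toℕ e + shift (inj₁ e)) % M   ≡⟨ cong (λ x → (x + shift (inj₁ e)) % M) (toℕ-↑ʳ m e) ⟨
    (toℕ (m ↑ʳ e) + shift (inj₁ e)) % M ∎
    where
      open ≡-Reasoning
      edge-backward : ∀ x m → x + (m + m) ≡ m + x + (0 + 1 * m)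
      edge-backward = solve-∀
  step-shift (arcStep a) = trans (toℕ-residue (suc (toℕ a)) M) (cong (_% M) (+-comm 1 (toℕ a)))

  arcs edges : (ℕ → Link G) → ℕ → ℕ
  arcs S zero = 0
  arcs S (suc t) = arcs S t + isArc (S t)
  edges S zero = 0
  edges S (suc t) = edges S t + isEdge (S t)

  arcs+edges : ∀ S t → arcs S t + edges S t ≡ t
  arcs+edges S zero = refl
  arcs+edges S (suc t) = begin
    arcs S t + isArc (S t) + (edges S t + isEdge (S t))  ≡⟨ regroup (arcs S t) _ (edges S t) _ ⟩
    (arcs S t + edges S t) + (isArc (S t) + isEdge (S t)) ≡⟨ cong₂ _+_ (arcs+edges S t) (isArc+isEdge (S t)) ⟩
    t + 1                                                 ≡⟨ +-comm t 1 ⟩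
    suc t                                                 ∎
    where
      open ≡-Reasoning
      regroup : ∀ A a B b → A + a + (B + b) ≡ (A + B) + (a + b)
      regroup = solve-∀
      isArc+isEdge : ∀ l → isArc l + isEdge l ≡ 1
      isArc+isEdge (inj₁ _) = refl
      isArc+isEdge (inj₂ _) = refl

  arcs-pos : ∀ S {i t a} → S i ≡ inj₂ a → i < t → 1 ≤ arcs S t
  arcs-pos S {i} {suc t} Sᵢ≡a (s≤s i≤t) with m≤n⇒m<n∨m≡n i≤t
  ... | inj₁ i<t = ≤-trans (arcs-pos S Sᵢ≡a i<t) (m≤m+n _ _)
  ... | inj₂ refl rewrite Sᵢ≡a = m≤n+m 1 (arcs S i)

  trail-potential : ∀ {k} (trail : ClosedTrail G k) → let open ClosedTrail trail in
    ∀ t → t ≤ k → toℕ (vertex t) ≡ (toℕ (vertex 0) + (arcs link t + edges link t * m)) % M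
  trail-potential trail zero _ =
    trans (sym (m<n⇒m%n≡m (toℕ<n (vertex 0)))) (cong (_% M) (sym (+-identityʳ (toℕ (vertex 0)))))
    where open ClosedTrail trail
  trail-potential trail (suc t) t<k = begin
    toℕ (vertex (suc t))                               ≡⟨ step-shift (step t t<k) ⟩
    (toℕ (vertex t) + shift l) % M                     ≡⟨ cong (λ y → (y + shift l) % M) potentialₜ ⟩
    ((x + (A + B * m)) % M + shift l) % M              ≡⟨ [m%d+n]%d≡[m+n]%d (x + (A + B * m)) (shift l) M ⟩
    (x + (A + B * m) + (isArc l + isEdge l * m)) % M   ≡⟨ cong (_% M) (accumulate x A B _ _ m) ⟩
    (x + (A + isArc l + (B + isEdge l) * m)) % M       ∎
    where
      open ClosedTrail trail
      open ≡-Reasoning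
      x = toℕ (vertex 0)
      A = arcs link t
      B = edges link t
      l = link t
      potentialₜ = trail-potential trail t (<⇒≤ t<k)
      accumulate : ∀ x A B a e m → x + (A + B * m) + (a + e * m) ≡ x + (A + a + (B + e) * m)
      accumulate = solve-∀

  short-trail-edges : ∀ {k} (trail : ClosedTrail G k) → k ≤ m →
                      ∀ i → i < k → ∃ λ e → ClosedTrail.link trail i ≡ inj₁ e
  short-trail-edges {k} trail k≤m i i<k with ClosedTrail.link trail i in linkᵢ≡
  ... | inj₁ e = e , refl
  ... | inj₂ a = ⊥-elim (no-double-multiple
    (arcs-pos link linkᵢ≡ i<k)
    (≤-trans (≤-reflexive (arcs+edges link k)) k≤m)
    ([m+n]%d≡m⇒d∣n _ _ M (sym (trans (cong toℕ closed) (trail-potential trail k ≤-refl)))))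
    where open ClosedTrail trail

  long-cycle : HasCycleOfLength G (suc m)
  long-cycle = closedTrail⇒cycle (s≤s z≤n) record
    { vertex = vertex
    ; link = link
    ; closed = toℕ-injective (sym (trans (toℕ-residue (m + m) M) (n%n≡0 M)))
    ; step = step
    ; link-injective = link-injective
    }
    where
      vertex : ℕ → Fin M
      vertex zero = zero
      vertex (suc i) = residue (m + i) M

      link : ℕ → Link G
      link zero = inj₁ zero
      link (suc i) = inj₂ (residue (m + i) M)

      step : ∀ i → i < suc m → Step G (vertex i) (vertex (suc i)) (link i)
      step zero _ = subst (λ b → Step G zero b (inj₁ zero))
        (toℕ-injective (trans (toℕ-↑ʳ m zero) (sym (toℕ-residue-< (+-monoʳ-< m (s≤s z≤n))))))
        (edgeFwd zero)
      step (suc i) _ = subst (λ b → Step G (vertex (suc i)) b (link (suc i)))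
        (trans (residue-suc (m + i) M) (cong (λ y → residue y M) (sym (+-suc m i))))
        (arcStep (residue (m + i) M))

      link-injective : ∀ i j → i < suc m → j < suc m → link i ≡ link j → i ≡ j
      link-injective zero zero _ _ _ = refl
      link-injective (suc i) (suc j) (s≤s i<m) (s≤s j<m) eq = cong suc (+-cancelˡ-≡ m i j (begin
        m + i                      ≡⟨ toℕ-residue-< (+-monoʳ-< m i<m) ⟨
        toℕ (residue (m + i) M)    ≡⟨ cong toℕ (inj₂-injective eq) ⟩
        toℕ (residue (m + j) M)    ≡⟨ toℕ-residue-< (+-monoʳ-< m j<m) ⟩
        m + j                      ∎))
        where open ≡-Reasoning

  is-1-1-graph : IsRZGGraph G 1 1 (suc m)
  is-1-1-graph = degree-one , outDegree-one , long-cycle , no-short-cycle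
    where
      open DegreeOne G degree-one using (no-edge-closedTrail)
      no-short-cycle : ∀ k → k < suc m → ¬ HasCycleOfLength G k
      no-short-cycle k k<g cycle =
        no-edge-closedTrail (proj₁ cycle) trail (short-trail-edges trail (s≤s⁻¹ k<g))
        where trail = cycle⇒closedTrail cycle

mainTheorem1 : (g : ℕ) → 5 ≤ g → MinOrderIs 1 1 g (2 * g ∸ 2)
mainTheorem1 (suc (suc k)) _ =
  subst (MinOrderIs 1 1 (2 + k)) (sym order≡M)
    (G , is-1-1-graph ,
     λ n H (deg , out , girth) → subst (_≤ n) order≡M (OneOneGraph.order-lowerBound H deg out girth))
  where
    open Construction k
    order≡M : 2 * (2 + k) ∸ 2 ≡ M
    order≡M = trans (+-suc k (suc (k + 0))) (cong (λ z → suc (k + suc z)) (+-identityʳ k))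
mainTheorem1 (suc zero) (s≤s ())
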